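{- Under the Modified CFLS coloring $\varphi$ of $K_n$ ($n=2^{m^2}$), there is no copy of $K_5$ which is a 2-2-2-2-2 coloring in which all five color classes are paths of length 2.
   Context: Let $m$ be a positive integer and $n=2^{m^2}$. The vertices of $K_n$ are the binary strings $v\in\{0,1\}^{m^2}$, written as $v=(v^{(1)},\dots,v^{(m)})$ with each block $v^{(k)}\in\{0,1\}^m$. Vertices (and blocks) are linearly ordered as binary integers: $x<y$ iff at the first bit where they differ, $x$ has 0 and $y$ has 1. For $x<y$, let $i$ be the first index with $x^{(i)}\ne y^{(i)}$; for $k\in[m]$ let $i_k$ be the first position at which the bits of $x^{(k)}$ and $y^{(k)}$ differ ($i_k=0$ if $x^{(k)}=y^{(k)}$), and let $\delta_k=+1$ if $x^{(k)}\le y^{(k)}$ and $\delta_k=-1$ if $x^{(k)}>y^{(k)}$. The Modified CFLS coloring assigns to edge $xy$ the color $\varphi(xy)=((i,\{x^{(i)},y^{(i)}\}),i_1,\dots,i_m,\delta_1,\dots,\delta_m)$. A copy of $K_5$ is a 2-2-2-2-2 coloring if its ten edges receive exactly five colors, each on exactly two edges; each color class is then either a matching (two disjoint edges) or a path of length 2 (two edges sharing a vertex). -}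

module Defs where

open import Data.Nat using (ℕ; zero; suc)
open import Data.Bool using (Bool; true; false; not; if_then_else_)
open import Data.Fin using (Fin; zero; suc)
open import Data.Vec using (Vec; []; _∷_; map; zipWith; concat)
open import Data.Product using (_×_; _,_; Σ; ∃; ∃-syntax)
open import Relation.Binary.PropositionalEquality using (_≡_; _≢_)
open import Relation.Nullary using (¬_; yes; no)
open import Relation.Binary using (DecidableEquality)
open import Data.Sum using (_⊎_)
import Data.Bool.Properties as BP
import Data.Vec.Properties as VP

Block : ℕ → Set
Block m = Vec Bool m

Vertex : ℕ → Set
Vertex m = Vec (Block m) m

-- Strict order of binary strings read as binary integers (same length):
-- x < y iff at the first differing bit x has 0 and y has 1.
lexLess : ∀ {k} → Vec Bool k → Vec Bool k → Bool
lexLess [] [] = false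
lexLess (false ∷ xs) (true ∷ ys) = true
lexLess (true ∷ xs) (false ∷ ys) = false
lexLess (false ∷ xs) (false ∷ ys) = lexLess xs ys
lexLess (true ∷ xs) (true ∷ ys) = lexLess xs ys

vLess : ∀ {m} → Vertex m → Vertex m → Bool
vLess x y = lexLess (concat x) (concat y)

-- 1-based index of the first position where two vectors differ; 0 if equal.
firstDiff : ∀ {a} {A : Set a} {k} → DecidableEquality A → Vec A k → Vec A k → ℕ
firstDiff eq [] [] = 0
firstDiff eq (a ∷ as) (b ∷ bs) with eq a b
... | no _ = 1
... | yes _ with firstDiff eq as bs
...   | zero = 0
...   | suc j = suc (suc j)

-- The pair of blocks at the first index where the block sequences differ
-- (returned as (min, max) – a canonical encoding of the unordered pair
-- {x^(i), y^(i)}); if there is no such index, the first blocks (never used).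
firstDiffBlocks : ∀ {m k} → Vec (Block m) (suc k) → Vec (Block m) (suc k) → Block m × Block m
firstDiffBlocks {m} (a ∷ []) (b ∷ []) = if lexLess a b then (a , b) else (b , a)
firstDiffBlocks {m} (a ∷ a' ∷ as) (b ∷ b' ∷ bs) with VP.≡-dec BP._≟_ a b
... | no _ = if lexLess a b then (a , b) else (b , a)
... | yes _ = firstDiffBlocks (a' ∷ as) (b' ∷ bs)

-- Color type: ((i, {x^(i), y^(i)}), i_1..i_m, δ_1..δ_m);
-- δ_k = true encodes +1, false encodes -1.
Color : ℕ → Set
Color m = (ℕ × (Block m × Block m)) × Vec ℕ m × Vec Bool m

-- The color of xy computed with x < y.
rawColor : ∀ {m} → Vertex m → Vertex m → Color m
rawColor {zero} x y = (firstDiff (VP.≡-dec BP._≟_) x y , ([] , [])) , [] , []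
rawColor {suc m} x y =
  ( (firstDiff (VP.≡-dec BP._≟_) x y , firstDiffBlocks x y)
  , zipWith (firstDiff BP._≟_) x y
  , zipWith (λ a b → not (lexLess b a)) x y )

φ : ∀ {m} → Vertex m → Vertex m → Color m
φ x y = if vLess x y then rawColor x y else rawColor y x

K5edge : Fin 10 → Fin 5 × Fin 5
K5edge zero = (zero , suc zero)
K5edge (suc zero) = (zero , suc (suc zero))
K5edge (suc (suc zero)) = (zero , suc (suc (suc zero)))
K5edge (suc (suc (suc zero))) = (zero , suc (suc (suc (suc zero))))
K5edge (suc (suc (suc (suc zero)))) = (suc zero , suc (suc zero))
K5edge (suc (suc (suc (suc (suc zero))))) = (suc zero , suc (suc (suc zero)))
K5edge (suc (suc (suc (suc (suc (suc zero)))))) = (suc zero , suc (suc (suc (suc zero))))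
K5edge (suc (suc (suc (suc (suc (suc (suc zero))))))) = (suc (suc zero) , suc (suc (suc zero)))
K5edge (suc (suc (suc (suc (suc (suc (suc (suc zero)))))))) = (suc (suc zero) , suc (suc (suc (suc zero))))
K5edge (suc (suc (suc (suc (suc (suc (suc (suc (suc zero))))))))) = (suc (suc (suc zero)) , suc (suc (suc (suc zero))))

Injective5 : ∀ {m} → (Fin 5 → Vertex m) → Set
Injective5 v = ∀ a b → v a ≡ v b → a ≡ b

edgeColor : ∀ {m} → (Fin 5 → Vertex m) → Fin 10 → Color m
edgeColor v e = φ (v (Data.Product.proj₁ (K5edge e))) (v (Data.Product.proj₂ (K5edge e)))

ShareVertex : Fin 10 → Fin 10 → Set
ShareVertex e f =
  let (a , b) = K5edge e ; (c , d) = K5edge f in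
  (a ≡ c) ⊎ (a ≡ d) ⊎ (b ≡ c) ⊎ (b ≡ d)

OnExactlyTwo : ∀ {m} → (Fin 5 → Vertex m) → Color m → Set
OnExactlyTwo v c = ∃[ e ] ∃[ f ] (e ≢ f × edgeColor v e ≡ c × edgeColor v f ≡ c
                   × (∀ g → edgeColor v g ≡ c → (g ≡ e) ⊎ (g ≡ f)))

Is22222 : ∀ {m} → (Fin 5 → Vertex m) → Set
Is22222 {m} v = Σ (Fin 5 → Color m) λ c → ((∀ j k → c j ≡ c k → j ≡ k)
                 × (∀ j → OnExactlyTwo v (c j))
                 × (∀ e → ∃[ j ] edgeColor v e ≡ c j))

-- Every color class is a path of length 2: two distinct edges of the same
-- color share a vertex.
AllClassesPaths : ∀ {m} → (Fin 5 → Vertex m) → Set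
AllClassesPaths v = ∀ e f → e ≢ f → edgeColor v e ≡ edgeColor v f → ShareVertex e f

-- Only the first component (i, {x^(i), y^(i)}) of the colour is needed. If two edges xy and xz
-- at a common vertex x carry the same such pair, then x^(i) differs from both y^(i) and z^(i)
-- while the unordered pairs coincide, so y^(i) = z^(i); as y and z also agree with x before
-- block i, the third side yz first differs strictly later than i. Hence the edge whose first
-- differing block index i is largest cannot belong to a colour class that is a path of length 2.
module Submission where

open import Defs

open import Data.Bool using (Bool; true; false; if_then_else_)
import Data.Bool.Properties as Bool
open import Data.Empty using (⊥-elim)
open import Data.Fin using (Fin; zero) renaming (_≟_ to _≟ᶠ_)
open import Data.Fin.Properties using (all?; any?)
open import Data.List using (allFin)
open import Data.List.Extrema.Nat using (argmax; f[xs]≤f[argmax])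
open import Data.List.Membership.Propositional.Properties using (∈-allFin)
open import Data.List.Relation.Unary.All using (lookup)
open import Data.Nat using (ℕ; zero; suc; _<_; _≤_; s≤s; z≤n)
open import Data.Nat.Properties using (<⇒≱; module ≤-Reasoning)
open import Data.Product using (_×_; _,_; proj₁; proj₂; ∃-syntax)
import Data.Product.Properties as Product
open import Data.Sum using (_⊎_; inj₁; inj₂)
open import Data.Vec using (Vec; []; _∷_)
import Data.Vec.Properties as Vec
open import Function using (_∘_)
open import Relation.Binary using (DecidableEquality)
open import Relation.Binary.PropositionalEquality
open import Relation.Nullary using (¬_; Dec; yes; no; ¬?)
open import Relation.Nullary.Decidable using (_⊎-dec_; _×-dec_; _→-dec_; toWitness; toSum)

-- firstDiff counts positions from 1 and returns 0 for equal vectors, so prepending a common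
-- element acts on it by bump rather than by suc.
bump : ℕ → ℕ
bump zero    = zero
bump (suc n) = suc (suc n)

bump-injective : ∀ {m n} → bump m ≡ bump n → m ≡ n
bump-injective {zero}  {zero}  _    = refl
bump-injective {suc m} {suc n} refl = refl

bump≢1 : ∀ {n} → bump n ≢ 1
bump≢1 {zero}  ()
bump≢1 {suc n} ()

bump-mono-< : ∀ {m n} → m < n → bump m < bump n
bump-mono-< {zero}  {suc n} _ = s≤s z≤n
bump-mono-< {suc m} {suc n} m<n = s≤s m<n

1<bump : ∀ {n} → 0 < n → 1 < bump n
1<bump {suc n} _ = s≤s (s≤s z≤n)

module _ {a} {A : Set a} (_≟_ : DecidableEquality A) where

  firstDiff-head≢ : ∀ {k x y} {xs ys : Vec A k} → x ≢ y → firstDiff _≟_ (x ∷ xs) (y ∷ ys) ≡ 1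
  firstDiff-head≢ {x = x} {y} x≢y with x ≟ y
  ... | yes x≡y = ⊥-elim (x≢y x≡y)
  ... | no _    = refl

  firstDiff-head≡ : ∀ {k} x (xs ys : Vec A k) →
                    firstDiff _≟_ (x ∷ xs) (x ∷ ys) ≡ bump (firstDiff _≟_ xs ys)
  firstDiff-head≡ x xs ys with x ≟ x
  ... | no x≢x = ⊥-elim (x≢x refl)
  ... | yes _ with firstDiff _≟_ xs ys
  ...   | zero  = refl
  ...   | suc _ = refl

  firstDiff≡0⇒≡ : ∀ {k} (xs ys : Vec A k) → firstDiff _≟_ xs ys ≡ 0 → xs ≡ ys
  firstDiff≡0⇒≡ []       []       _  = refl
  firstDiff≡0⇒≡ (x ∷ xs) (y ∷ ys) eq with toSum (x ≟ y)
  ... | inj₂ x≢y  = ⊥-elim (bump≢1 {0} (trans (sym eq) (firstDiff-head≢ x≢y)))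
  ... | inj₁ refl = cong (x ∷_)
        (firstDiff≡0⇒≡ xs ys (bump-injective (trans (sym (firstDiff-head≡ x xs ys)) eq)))

  ≢⇒0<firstDiff : ∀ {k} {xs ys : Vec A k} → xs ≢ ys → 0 < firstDiff _≟_ xs ys
  ≢⇒0<firstDiff {xs = xs} {ys} xs≢ys with firstDiff _≟_ xs ys in eq
  ... | zero  = ⊥-elim (xs≢ys (firstDiff≡0⇒≡ xs ys eq))
  ... | suc _ = s≤s z≤n

  firstDiff-sym : ∀ {k} (xs ys : Vec A k) → firstDiff _≟_ xs ys ≡ firstDiff _≟_ ys xs
  firstDiff-sym []       []       = refl
  firstDiff-sym (x ∷ xs) (y ∷ ys) with toSum (x ≟ y)
  ... | inj₂ x≢y  = trans (firstDiff-head≢ x≢y) (sym (firstDiff-head≢ (x≢y ∘ sym)))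
  ... | inj₁ refl = begin
    firstDiff _≟_ (x ∷ xs) (x ∷ ys) ≡⟨ firstDiff-head≡ x xs ys ⟩
    bump (firstDiff _≟_ xs ys)      ≡⟨ cong bump (firstDiff-sym xs ys) ⟩
    bump (firstDiff _≟_ ys xs)      ≡⟨ firstDiff-head≡ x ys xs ⟨
    firstDiff _≟_ (x ∷ ys) (x ∷ xs) ∎
    where open ≡-Reasoning

lexLess-asym : ∀ {k} (a b : Vec Bool k) → lexLess a b ≡ true → lexLess b a ≡ false
lexLess-asym []          []          ()
lexLess-asym (false ∷ a) (true ∷ b)  _ = refl
lexLess-asym (true ∷ a)  (false ∷ b) ()
lexLess-asym (false ∷ a) (false ∷ b) p = lexLess-asym a b p
lexLess-asym (true ∷ a)  (true ∷ b)  p = lexLess-asym a b p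

lexLess-connex : ∀ {k} (a b : Vec Bool k) → lexLess a b ≡ false → lexLess b a ≡ false → a ≡ b
lexLess-connex []          []          _  _  = refl
lexLess-connex (false ∷ a) (true ∷ b)  () _
lexLess-connex (true ∷ a)  (false ∷ b) _  ()
lexLess-connex (false ∷ a) (false ∷ b) p q = cong (false ∷_) (lexLess-connex a b p q)
lexLess-connex (true ∷ a)  (true ∷ b)  p q = cong (true ∷_) (lexLess-connex a b p q)

unorderedPair : ∀ {k} → Vec Bool k → Vec Bool k → Vec Bool k × Vec Bool k
unorderedPair a b = if lexLess a b then (a , b) else (b , a)

unorderedPair-comm : ∀ {k} (a b : Vec Bool k) → unorderedPair a b ≡ unorderedPair b a
unorderedPair-comm a b with lexLess a b in ab | lexLess b a in ba
... | true  | true  = ⊥-elim (true≢false (trans (sym ba) (lexLess-asym a b ab)))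
  where true≢false : true ≢ false
        true≢false ()
... | true  | false = refl
... | false | true  = refl
... | false | false with lexLess-connex a b ab ba
...   | refl = refl

unorderedPair-cancelˡ : ∀ {k} {a b c : Vec Bool k} → a ≢ b → a ≢ c →
                        unorderedPair a b ≡ unorderedPair a c → b ≡ c
unorderedPair-cancelˡ {a = a} {b} {c} a≢b a≢c eq with lexLess a b | lexLess a c
... | true  | true  = cong proj₂ eq
... | true  | false = ⊥-elim (a≢c (cong proj₁ eq))
... | false | true  = ⊥-elim (a≢b (sym (cong proj₁ eq)))
... | false | false = cong proj₁ eq

_≟ᴮ_ : ∀ {n} → DecidableEquality (Block n)
_≟ᴮ_ = Vec.≡-dec Bool._≟_

firstDiffBlocks-head≢ : ∀ {n k} {a b : Block n} (as bs : Vec (Block n) k) → a ≢ b →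
                        firstDiffBlocks (a ∷ as) (b ∷ bs) ≡ unorderedPair a b
firstDiffBlocks-head≢ []      []      _   = refl
firstDiffBlocks-head≢ {a = a} {b} (_ ∷ _) (_ ∷ _) a≢b with a ≟ᴮ b
... | yes a≡b = ⊥-elim (a≢b a≡b)
... | no _    = refl

firstDiffBlocks-head≡ : ∀ {n k} (a a' b' : Block n) (as bs : Vec (Block n) k) →
                        firstDiffBlocks (a ∷ a' ∷ as) (a ∷ b' ∷ bs) ≡ firstDiffBlocks (a' ∷ as) (b' ∷ bs)
firstDiffBlocks-head≡ a _ _ _ _ with a ≟ᴮ a
... | yes _   = refl
... | no a≢a = ⊥-elim (a≢a refl)

firstDiffBlocks-comm : ∀ {n k} (x y : Vec (Block n) (suc k)) → firstDiffBlocks x y ≡ firstDiffBlocks y x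
firstDiffBlocks-comm (a ∷ [])     (b ∷ [])     = unorderedPair-comm a b
firstDiffBlocks-comm (a ∷ a' ∷ as) (b ∷ b' ∷ bs) with toSum (a ≟ᴮ b)
... | inj₂ a≢b = begin
  firstDiffBlocks (a ∷ a' ∷ as) (b ∷ b' ∷ bs) ≡⟨ firstDiffBlocks-head≢ (a' ∷ as) (b' ∷ bs) a≢b ⟩
  unorderedPair a b                           ≡⟨ unorderedPair-comm a b ⟩
  unorderedPair b a                           ≡⟨ firstDiffBlocks-head≢ (b' ∷ bs) (a' ∷ as) (a≢b ∘ sym) ⟨
  firstDiffBlocks (b ∷ b' ∷ bs) (a ∷ a' ∷ as) ∎
  where open ≡-Reasoning
... | inj₁ refl = begin
  firstDiffBlocks (a ∷ a' ∷ as) (a ∷ b' ∷ bs) ≡⟨ firstDiffBlocks-head≡ a a' b' as bs ⟩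
  firstDiffBlocks (a' ∷ as) (b' ∷ bs)         ≡⟨ firstDiffBlocks-comm (a' ∷ as) (b' ∷ bs) ⟩
  firstDiffBlocks (b' ∷ bs) (a' ∷ as)         ≡⟨ firstDiffBlocks-head≡ a b' a' bs as ⟨
  firstDiffBlocks (a ∷ b' ∷ bs) (a ∷ a' ∷ as) ∎
  where open ≡-Reasoning

BlockKey : ℕ → Set
BlockKey n = ℕ × (Block n × Block n)

blockKey : ∀ {n k} → Vec (Block n) (suc k) → Vec (Block n) (suc k) → BlockKey n
blockKey x y = firstDiff _≟ᴮ_ x y , firstDiffBlocks x y

blockKey-comm : ∀ {n k} (x y : Vec (Block n) (suc k)) → blockKey x y ≡ blockKey y x
blockKey-comm x y = cong₂ _,_ (firstDiff-sym _≟ᴮ_ x y) (firstDiffBlocks-comm x y)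

proj₁∘φ≡blockKey : ∀ {m} (x y : Vertex (suc m)) → proj₁ (φ x y) ≡ blockKey x y
proj₁∘φ≡blockKey x y with vLess x y
... | true  = refl
... | false = blockKey-comm y x

sameBlockKey-head≢⇒firstDiff< : ∀ {n k} {a b c : Block n} (as bs cs : Vec (Block n) k) →
  a ≢ b → a ≢ c → b ∷ bs ≢ c ∷ cs → blockKey (a ∷ as) (b ∷ bs) ≡ blockKey (a ∷ as) (c ∷ cs) →
  firstDiff _≟ᴮ_ (a ∷ as) (b ∷ bs) < firstDiff _≟ᴮ_ (b ∷ bs) (c ∷ cs)
sameBlockKey-head≢⇒firstDiff< {a = a} {b} {c} as bs cs a≢b a≢c y≢z key
  with unorderedPair-cancelˡ a≢b a≢c (begin
    unorderedPair a b                 ≡⟨ firstDiffBlocks-head≢ as bs a≢b ⟨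
    firstDiffBlocks (a ∷ as) (b ∷ bs) ≡⟨ cong proj₂ key ⟩
    firstDiffBlocks (a ∷ as) (c ∷ cs) ≡⟨ firstDiffBlocks-head≢ as cs a≢c ⟩
    unorderedPair a c                 ∎)
  where open ≡-Reasoning
... | refl = begin-strict
    firstDiff _≟ᴮ_ (a ∷ as) (b ∷ bs) ≡⟨ firstDiff-head≢ _≟ᴮ_ a≢b ⟩
    1                                <⟨ 1<bump (≢⇒0<firstDiff _≟ᴮ_ (y≢z ∘ cong (b ∷_))) ⟩
    bump (firstDiff _≟ᴮ_ bs cs)      ≡⟨ firstDiff-head≡ _≟ᴮ_ b bs cs ⟨
    firstDiff _≟ᴮ_ (b ∷ bs) (b ∷ cs) ∎
  where open ≤-Reasoning

sameBlockKey⇒firstDiff< : ∀ {n k} (x y z : Vec (Block n) (suc k)) → x ≢ y → y ≢ z →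
                          blockKey x y ≡ blockKey x z → firstDiff _≟ᴮ_ x y < firstDiff _≟ᴮ_ y z
sameBlockKey⇒firstDiff< (a ∷ as) (b ∷ bs) (c ∷ cs) x≢y y≢z key
  with toSum (a ≟ᴮ b) | toSum (a ≟ᴮ c)
... | inj₂ a≢b | inj₂ a≢c = sameBlockKey-head≢⇒firstDiff< as bs cs a≢b a≢c y≢z key
... | inj₂ a≢b | inj₁ refl = ⊥-elim (bump≢1 (begin
      bump (firstDiff _≟ᴮ_ as cs)      ≡⟨ firstDiff-head≡ _≟ᴮ_ a as cs ⟨
      firstDiff _≟ᴮ_ (a ∷ as) (a ∷ cs) ≡⟨ cong proj₁ key ⟨
      firstDiff _≟ᴮ_ (a ∷ as) (b ∷ bs) ≡⟨ firstDiff-head≢ _≟ᴮ_ a≢b ⟩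
      1                                ∎))
  where open ≡-Reasoning
... | inj₁ refl | inj₂ a≢c = ⊥-elim (bump≢1 (begin
      bump (firstDiff _≟ᴮ_ as bs)      ≡⟨ firstDiff-head≡ _≟ᴮ_ a as bs ⟨
      firstDiff _≟ᴮ_ (a ∷ as) (a ∷ bs) ≡⟨ cong proj₁ key ⟩
      firstDiff _≟ᴮ_ (a ∷ as) (c ∷ cs) ≡⟨ firstDiff-head≢ _≟ᴮ_ a≢c ⟩
      1                                ∎))
  where open ≡-Reasoning
sameBlockKey⇒firstDiff< (a ∷ []) (_ ∷ []) (_ ∷ []) x≢y _ _ | inj₁ refl | inj₁ refl = ⊥-elim (x≢y refl)
sameBlockKey⇒firstDiff< (a ∷ a' ∷ as) (_ ∷ b' ∷ bs) (_ ∷ c' ∷ cs) x≢y y≢z key | inj₁ refl | inj₁ refl =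
  begin-strict
    firstDiff _≟ᴮ_ (a ∷ xs) (a ∷ ys)    ≡⟨ firstDiff-head≡ _≟ᴮ_ a xs ys ⟩
    bump (firstDiff _≟ᴮ_ xs ys)         <⟨ bump-mono-< (sameBlockKey⇒firstDiff< xs ys zs
                                              (x≢y ∘ cong (a ∷_)) (y≢z ∘ cong (a ∷_)) tailKey) ⟩
    bump (firstDiff _≟ᴮ_ ys zs)         ≡⟨ firstDiff-head≡ _≟ᴮ_ a ys zs ⟨
    firstDiff _≟ᴮ_ (a ∷ ys) (a ∷ zs)    ∎
  where
  open ≤-Reasoning
  xs = a' ∷ as
  ys = b' ∷ bs
  zs = c' ∷ cs
  tailKey : blockKey xs ys ≡ blockKey xs zs
  tailKey = cong₂ _,_
    (bump-injective (trans (sym (firstDiff-head≡ _≟ᴮ_ a xs ys))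
                    (trans (cong proj₁ key) (firstDiff-head≡ _≟ᴮ_ a xs zs))))
    (trans (sym (firstDiffBlocks-head≡ a a' b' as bs))
           (trans (cong proj₂ key) (firstDiffBlocks-head≡ a a' c' as cs)))

-- The opaque blocks keep with-abstraction from normalising the argmax over a symbolic
-- colouring and the exhaustive searches over K5, either of which exhausts memory.
opaque
  ∃-argmax : ∀ {n} (d : Fin (suc n) → ℕ) → ∃[ e ] (∀ f → d f ≤ d e)
  ∃-argmax d = argmax d zero (allFin _) , λ f → lookup (f[xs]≤f[argmax] {f = d} zero (allFin _)) (∈-allFin f)

sameColourPartner : ∀ {m} (v : Fin 5 → Vertex m) → Is22222 v → ∀ e →
                    ∃[ f ] (e ≢ f × edgeColor v e ≡ edgeColor v f)
sameColourPartner v (_ , _ , exactlyTwo , covered) e with covered e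
... | j , e↦j with exactlyTwo j
...   | f₁ , f₂ , f₁≢f₂ , f₁↦j , f₂↦j , _ with e ≟ᶠ f₁
...     | yes refl = f₂ , f₁≢f₂ , trans e↦j (sym f₂↦j)
...     | no e≢f₁  = f₁ , e≢f₁  , trans e↦j (sym f₁↦j)

Joins : Fin 10 → Fin 5 → Fin 5 → Set
Joins e u p = K5edge e ≡ (u , p) ⊎ K5edge e ≡ (p , u)

joins? : ∀ e u p → Dec (Joins e u p)
joins? e u p = K5edge e ≟² (u , p) ⊎-dec K5edge e ≟² (p , u)
  where _≟²_ = Product.≡-dec _≟ᶠ_ _≟ᶠ_

shareVertex? : ∀ e f → Dec (ShareVertex e f)
shareVertex? e f = let (a , b) = K5edge e; (c , d) = K5edge f in
  a ≟ᶠ c ⊎-dec a ≟ᶠ d ⊎-dec b ≟ᶠ c ⊎-dec b ≟ᶠ d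

opaque
  edgeBetween : ∀ p q → p ≢ q → ∃[ e ] Joins e p q
  edgeBetween = toWitness {a? = all? λ p → all? λ q → ¬? (p ≟ᶠ q) →-dec any? λ e → joins? e p q} _

  shareVertex⇒path : ∀ e f → e ≢ f → ShareVertex e f →
                     ∃[ u ] ∃[ p ] ∃[ q ] (Joins e u p × Joins f u q × u ≢ p × p ≢ q)
  shareVertex⇒path = toWitness {a? = all? λ e → all? λ f → ¬? (e ≟ᶠ f) →-dec shareVertex? e f →-dec
    any? λ u → any? λ p → any? λ q →
      joins? e u p ×-dec joins? f u q ×-dec ¬? (u ≟ᶠ p) ×-dec ¬? (p ≟ᶠ q)} _

edgeDepth : ∀ {m} → (Fin 5 → Vertex (suc m)) → Fin 10 → ℕ
edgeDepth v e = proj₁ (proj₁ (edgeColor v e))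

Joins⇒blockKey : ∀ {m} (v : Fin 5 → Vertex (suc m)) {e u p} → Joins e u p →
                 proj₁ (edgeColor v e) ≡ blockKey (v u) (v p)
Joins⇒blockKey v {u = u} {p} (inj₁ eq) =
  trans (cong (λ (a , b) → proj₁ (φ (v a) (v b))) eq) (proj₁∘φ≡blockKey (v u) (v p))
Joins⇒blockKey v {u = u} {p} (inj₂ eq) =
  trans (cong (λ (a , b) → proj₁ (φ (v a) (v b))) eq)
        (trans (proj₁∘φ≡blockKey (v p) (v u)) (blockKey-comm (v p) (v u)))

pathClass⇒deeperEdge : ∀ {m} (v : Fin 5 → Vertex (suc m)) → Injective5 v → ∀ {e f} → e ≢ f →
                       edgeColor v e ≡ edgeColor v f → ShareVertex e f →
                       ∃[ r ] edgeDepth v e < edgeDepth v r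
pathClass⇒deeperEdge v inj {e} {f} e≢f sameColour share with shareVertex⇒path e f e≢f share
... | u , p , q , e-up , f-uq , u≢p , p≢q with edgeBetween p q p≢q
...   | r , r-pq = r , subst₂ _<_ (sym depth-e) (sym depth-r) pq-deeper
  where
  depth-e : edgeDepth v e ≡ firstDiff _≟ᴮ_ (v u) (v p)
  depth-e = cong proj₁ (Joins⇒blockKey v e-up)
  depth-r : edgeDepth v r ≡ firstDiff _≟ᴮ_ (v p) (v q)
  depth-r = cong proj₁ (Joins⇒blockKey v r-pq)
  sameKey : blockKey (v u) (v p) ≡ blockKey (v u) (v q)
  sameKey = trans (sym (Joins⇒blockKey v e-up)) (trans (cong proj₁ sameColour) (Joins⇒blockKey v f-uq))
  pq-deeper : firstDiff _≟ᴮ_ (v u) (v p) < firstDiff _≟ᴮ_ (v p) (v q)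
  pq-deeper = sameBlockKey⇒firstDiff< (v u) (v p) (v q) (u≢p ∘ inj u p) (p≢q ∘ inj p q) sameKey

lemma13 : (m : ℕ) → (v : Fin 5 → Vertex (suc m)) →
    ¬ (Injective5 v × Is22222 v × AllClassesPaths v)
lemma13 m v (inj , is22222 , paths) with ∃-argmax (edgeDepth v)
... | e , e-deepest with sameColourPartner v is22222 e
...   | f , e≢f , sameColour with pathClass⇒deeperEdge v inj e≢f sameColour (paths e f e≢f sameColour)
...     | r , e<r = <⇒≱ e<r (e-deepest r)
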